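{- Let $\varphi=\Pi\land\Sigma$ be a quantifier-free symbolic heap and let $\{\phi_i\}_{i\in I}$ be a finite family of symbolic heaps. For every store $s$, the following are equivalent: (i) for every $\varphi'\in\mathrm{Perm}(\varphi)$, $s\models \widetilde{\varphi'}\to\bigvee\{\widetilde{\phi'}\mid i\in I,\ \phi'\in\mathrm{Perm}(\phi_i)\}$; (ii) $s\models \varphi\to\bigvee_{i\in I}\phi_i$.
   Context: Terms: $t::=x\mid 0\mid 1\mid 2\mid\cdots\mid t+t$ over variables $x$, interpreted in the natural numbers $N$. A store is a map $s$ from variables to $N$, extended to terms by $s(n)=n$ and $s(t+u)=s(t)+s(u)$. A heap is a finite partial function $h$ from $N\setminus\{0\}$ to $N$ (points-to is binary). A pure formula is a formula of Presburger arithmetic. Spatial formulas: $\Sigma::=\mathrm{Emp}\mid t\mapsto u\mid \mathrm{Arr}(t,u)\mid \Sigma*\Sigma$. A symbolic heap is $\exists\vec x(\Pi\land\Sigma)$ with $\Pi$ pure; it is quantifier-free (QF) if $\vec x$ is empty (the pure part may still contain quantifiers). Satisfaction: $s,h\models$ a pure formula iff it holds under $s$; $s,h\models\mathrm{Emp}$ iff $\mathrm{Dom}(h)=\emptyset$; $s,h\models t\mapsto u$ iff $\mathrm{Dom}(h)=\{s(t)\}$ and $h(s(t))=s(u)$; $s,h\models\mathrm{Arr}(t,u)$ iff $s(t)\le s(u)$ and $\mathrm{Dom}(h)=\{x\mid s(t)\le x\le s(u)\}$; $s,h\models F_1*F_2$ iff $h=h_1+h_2$ (disjoint union) with $s,h_1\models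 F_1$, $s,h_2\models F_2$; $\land,\neg,\exists,\lor,\to$ are interpreted classically with $h$ fixed. We write $s\models F$ if $s,h\models F$ for all heaps $h$. Sortedness: for a spatial formula $\Sigma$, delete its $\mathrm{Emp}$ atoms to obtain the sequence $\sigma_1*\cdots*\sigma_n$ (order as written). Let the start address of $t\mapsto u$ or $\mathrm{Arr}(t,u)$ be $t$, and its end address be $t$ for $t\mapsto u$ and $u$ for $\mathrm{Arr}(t,u)$. $\mathrm{Sorted}(\Sigma)$ is the pure formula consisting of the conjunction of: $0<$ (start address of $\sigma_1$) if $n\ge1$; $t\le u$ for each $\sigma_k=\mathrm{Arr}(t,u)$; and (end address of $\sigma_k$) $<$ (start address of $\sigma_{k+1}$) for $1\le k<n$ (empty conjunction is true). For $\phi=\exists\vec x(\Pi\land\Sigma)$, $\widetilde{\phi}$ denotes $\exists\vec x(\Pi\land\mathrm{Sorted}(\Sigma)\land\Sigma)$. $\mathrm{Perm}(\phi)$ is the set of symbolic heaps $\exists\vec x(\Pi\land\Sigma')$ where $\Sigma'$ is obtained by permuting the $*$-separated atoms of $\Sigma$. -}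

module Defs where

open import Data.Nat using (ℕ; zero; suc; _+_; _≤_; _<_)
open import Data.Nat.Properties using (_≟_)
open import Data.Fin using (Fin)
open import Data.List using (List; []; _∷_)
open import Data.List.Relation.Binary.Permutation.Propositional using (_↭_)
open import Data.Maybe using (Maybe; just; nothing)
open import Data.Product using (_×_; _,_; ∃; ∃-syntax) renaming (Σ to Sg)
open import Data.Sum using (_⊎_)
open import Data.Unit using (⊤)
open import Data.Empty using (⊥)
open import Relation.Nullary using (¬_; yes; no)
open import Relation.Binary.PropositionalEquality using (_≡_; _≢_)
open import Function.Bundles using (_⇔_)

Var : Set
Var = ℕ

data Term : Set where
  var  : Var → Term
  num  : ℕ → Term
  _⊕_  : Term → Term → Term

Store : Set
Store = Var → ℕ

⟦_⟧t : Term → Store → ℕ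
⟦ var x ⟧t s = s x
⟦ num n ⟧t s = n
⟦ t ⊕ u ⟧t s = ⟦ t ⟧t s + ⟦ u ⟧t s

_[_↦_] : Store → Var → ℕ → Store
(s [ x ↦ n ]) y with y ≟ x
... | yes _ = n
... | no  _ = s y

data PF : Set where
  true false  : PF
  _≐_ _≼_ _≺_ : Term → Term → PF
  _∧'_ _∨'_ _⇒'_ : PF → PF → PF
  ¬'_         : PF → PF
  ∃'_·_ ∀'_·_ : Var → PF → PF

⟦_⟧p : PF → Store → Set
⟦ true ⟧p s = ⊤
⟦ false ⟧p s = ⊥
⟦ t ≐ u ⟧p s = ⟦ t ⟧t s ≡ ⟦ u ⟧t s
⟦ t ≼ u ⟧p s = ⟦ t ⟧t s ≤ ⟦ u ⟧t s
⟦ t ≺ u ⟧p s = ⟦ t ⟧t s < ⟦ u ⟧t s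
⟦ A ∧' B ⟧p s = ⟦ A ⟧p s × ⟦ B ⟧p s
⟦ A ∨' B ⟧p s = ⟦ A ⟧p s ⊎ ⟦ B ⟧p s
⟦ A ⇒' B ⟧p s = ⟦ A ⟧p s → ⟦ B ⟧p s
⟦ ¬' A ⟧p s = ¬ ⟦ A ⟧p s
⟦ ∃' x · A ⟧p s = Sg ℕ (λ n → ⟦ A ⟧p (s [ x ↦ n ]))
⟦ ∀' x · A ⟧p s = (n : ℕ) → ⟦ A ⟧p (s [ x ↦ n ])

record Heap : Set where
  field
    get    : ℕ → Maybe ℕ
    get0   : get 0 ≡ nothing
    finite : ∃[ b ] ((a : ℕ) → b ≤ a → get a ≡ nothing)
open Heap public

InDom : Heap → ℕ → Set
InDom h a = ∃[ v ] (get h a ≡ just v)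

_≈_⊎ₕ_ : Heap → Heap → Heap → Set
h ≈ h₁ ⊎ₕ h₂ = (a : ℕ) →
  (get h₂ a ≡ nothing × get h a ≡ get h₁ a) ⊎
  (get h₁ a ≡ nothing × get h a ≡ get h₂ a)

-- Spatial formulas, as the list of their *-separated atoms
-- ([] stands for Emp; a ∷ Σ stands for a * Σ)

data Cell : Set where
  _↦ₛ_ : Term → Term → Cell
  Arr  : Term → Term → Cell

data Atom : Set where
  Emp  : Atom
  cell : Cell → Atom

Spatial : Set
Spatial = List Atom

satCell : Store → Heap → Cell → Set
satCell s h (t ↦ₛ u) =
  get h (⟦ t ⟧t s) ≡ just (⟦ u ⟧t s) ×
  ((a : ℕ) → InDom h a → a ≡ ⟦ t ⟧t s)
satCell s h (Arr t u) =
  ⟦ t ⟧t s ≤ ⟦ u ⟧t s ×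
  ((a : ℕ) → InDom h a ⇔ (⟦ t ⟧t s ≤ a × a ≤ ⟦ u ⟧t s))

satAtom : Store → Heap → Atom → Set
satAtom s h Emp = (a : ℕ) → ¬ InDom h a
satAtom s h (cell c) = satCell s h c

satSp : Store → Heap → Spatial → Set
satSp s h [] = (a : ℕ) → ¬ InDom h a
satSp s h (σ ∷ Σ) = ∃[ h₁ ] ∃[ h₂ ] (h ≈ h₁ ⊎ₕ h₂ × satAtom s h₁ σ × satSp s h₂ Σ)

record SH : Set where
  constructor ⟨∃_·_∧_⟩
  field
    vars    : List Var
    pure    : PF
    spatial : Spatial
open SH public

satEx : List Var → (Store → Set) → Store → Set
satEx [] P s = P s
satEx (x ∷ xs) P s = Sg ℕ (λ n → satEx xs P (s [ x ↦ n ]))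

_,_⊨_ : Store → Heap → SH → Set
s , h ⊨ φ = satEx (vars φ) (λ s' → ⟦ pure φ ⟧p s' × satSp s' h (spatial φ)) s

deleteEmp : Spatial → List Cell
deleteEmp [] = []
deleteEmp (Emp ∷ Σ) = deleteEmp Σ
deleteEmp (cell c ∷ Σ) = c ∷ deleteEmp Σ

startAddr endAddr : Cell → Term
startAddr (t ↦ₛ u) = t
startAddr (Arr t u) = t
endAddr (t ↦ₛ u) = t
endAddr (Arr t u) = u

arrCond : Cell → PF
arrCond (t ↦ₛ u) = true
arrCond (Arr t u) = t ≼ u

firstCond : List Cell → PF
firstCond [] = true
firstCond (c ∷ _) = num 0 ≺ startAddr c

chainCond : List Cell → PF
chainCond [] = true
chainCond (c ∷ []) = arrCond c
chainCond (c ∷ d ∷ cs) = arrCond c ∧' ((endAddr c ≺ startAddr d) ∧' chainCond (d ∷ cs))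

Sorted : Spatial → PF
Sorted Σ = firstCond (deleteEmp Σ) ∧' chainCond (deleteEmp Σ)

tilde : SH → SH
tilde ⟨∃ xs · Π ∧ Σ ⟩ = ⟨∃ xs · (Π ∧' Sorted Σ) ∧ Σ ⟩

_∈Perm_ : SH → SH → Set
ψ ∈Perm φ = vars ψ ≡ vars φ × pure ψ ≡ pure φ × spatial ψ ↭ spatial φ

-- s ⊨ F → G  (for all heaps h)
-- (i): ∀ φ' ∈ Perm(φ). s ⊨ φ̃' → ⋁ { ψ̃ | i ∈ I, ψ ∈ Perm(φ_i) }
Cond-i : Store → SH → (n : ℕ) → (Fin n → SH) → Set
Cond-i s φ n ϕ =
  (φ' : SH) → φ' ∈Perm φ → (h : Heap) → s , h ⊨ tilde φ' →
  ∃[ i ] ∃[ ψ ] (ψ ∈Perm ϕ i × s , h ⊨ tilde ψ)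

Cond-ii : Store → SH → (n : ℕ) → (Fin n → SH) → Set
Cond-ii s φ n ϕ =
  (h : Heap) → s , h ⊨ φ → ∃[ i ] (s , h ⊨ ϕ i)

module Submission where

-- Both directions rest on two facts about an arbitrary symbolic heap ψ:
--   * soundness of sorting: a model of ψ̃' for ψ' ∈ Perm(ψ) is a model of ψ,
--     because satisfaction of a spatial formula is invariant under
--     permutation of its atoms (this needs a reassociation law for disjoint
--     union of heaps, stated pointwise on the values at one address);
--   * completeness of sorting: every model of ψ is a model of ψ̃' for some
--     ψ' ∈ Perm(ψ).  The cells of a model occupy pairwise disjoint, nonempty
--     address intervals above 0, so insertion sort by address puts the atoms
--     in an order satisfying Sorted; the existential quantifiers of ψ are
--     handled by pulling the chosen permutation out of them.

open import Defs
open import Data.Nat using (ℕ; zero; suc; _≤_; _<_; _<?_; z≤n; s≤s)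
open import Data.Nat.Properties using (≤-total; ≤-refl; ≮⇒≥; ≤-antisym)
open import Data.Fin using (Fin)
open import Data.List using (List; []; _∷_)
open import Data.List.Relation.Binary.Permutation.Propositional
  using (_↭_; refl; prep; swap; trans; ↭-sym)
open import Data.List.Relation.Unary.All using (All; []; _∷_)
import Data.List.Relation.Unary.All as All
open import Data.Maybe using (Maybe; just; nothing)
open import Data.Product using (_×_; _,_; ∃-syntax; proj₁; proj₂)
open import Data.Sum using (_⊎_; inj₁; inj₂)
open import Data.Unit using (⊤; tt)
open import Data.Empty using (⊥; ⊥-elim)
open import Relation.Nullary using (yes; no)
open import Relation.Binary.PropositionalEquality
  using (_≡_; sym; subst) renaming (refl to ≡refl; trans to ≡trans)
open import Function.Bundles using (_⇔_; mk⇔; Equivalence)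

-- By definition,
-- h ≈ h₁ ⊎ₕ h₂ is Split (get h a) (get h₁ a) (get h₂ a) at every a.
Split : Maybe ℕ → Maybe ℕ → Maybe ℕ → Set
Split x y z = (z ≡ nothing × x ≡ y) ⊎ (y ≡ nothing × x ≡ z)

_∖_ : Maybe ℕ → Maybe ℕ → Maybe ℕ
x ∖ nothing = x
x ∖ just _  = nothing

nothing∖ : ∀ y → nothing ∖ y ≡ nothing
nothing∖ nothing  = ≡refl
nothing∖ (just _) = ≡refl

-- Reassociation: from x = y ⊎ (u ⊎ w) get x = u ⊎ (x ∖ u) and x ∖ u = y ⊎ w.
-- This is what lets two adjacent *-conjuncts be swapped.
split-rotate : ∀ {x y z u w} → Split x y z → Split z u w →
  Split x u (x ∖ u) × Split (x ∖ u) y w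
split-rotate (inj₁ (≡refl , ≡refl)) (inj₁ (≡refl , ≡refl)) = inj₂ (≡refl , ≡refl) , inj₁ (≡refl , ≡refl)
split-rotate (inj₁ (≡refl , ≡refl)) (inj₂ (≡refl , ≡refl)) = inj₂ (≡refl , ≡refl) , inj₁ (≡refl , ≡refl)
split-rotate {u = nothing} (inj₂ (≡refl , ≡refl)) (inj₁ (≡refl , ≡refl)) = inj₂ (≡refl , ≡refl) , inj₂ (≡refl , ≡refl)
split-rotate {u = just _}  (inj₂ (≡refl , ≡refl)) (inj₁ (≡refl , ≡refl)) = inj₁ (≡refl , ≡refl) , inj₂ (≡refl , ≡refl)
split-rotate (inj₂ (≡refl , ≡refl)) (inj₂ (≡refl , ≡refl)) = inj₂ (≡refl , ≡refl) , inj₂ (≡refl , ≡refl)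

_∖ₕ_ : Heap → Heap → Heap
h ∖ₕ h' = record
  { get    = λ a → get h a ∖ get h' a
  ; get0   = subst (λ v → v ∖ get h' 0 ≡ nothing) (sym (get0 h)) (nothing∖ (get h' 0))
  ; finite = proj₁ (finite h) , λ a b≤a →
      subst (λ v → v ∖ get h' a ≡ nothing) (sym (proj₂ (finite h) a b≤a)) (nothing∖ (get h' a))
  }

satSp-↭ : ∀ {s Σ Σ'} → Σ ↭ Σ' → ∀ h → satSp s h Σ → satSp s h Σ'
satSp-↭ refl h sat = sat
satSp-↭ (prep σ p) h (h₁ , h₂ , split , sat₁ , sat₂) = h₁ , h₂ , split , sat₁ , satSp-↭ p h₂ sat₂
satSp-↭ (swap σ τ p) h (h₁ , h₂ , split₁ , sat₁ , h₃ , h₄ , split₂ , sat₃ , sat₄) =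
  h₃ , h ∖ₕ h₃ , (λ a → proj₁ (rotate a)) , sat₃ ,
  h₁ , h₄ , (λ a → proj₂ (rotate a)) , sat₁ , satSp-↭ p h₄ sat₄
  where rotate = λ a → split-rotate (split₁ a) (split₂ a)
satSp-↭ (trans p q) h sat = satSp-↭ q h (satSp-↭ p h sat)

inDom-⊎ˡ : ∀ {h h₁ h₂ a} → h ≈ h₁ ⊎ₕ h₂ → InDom h₁ a → InDom h a
inDom-⊎ˡ {a = a} split (v , e) with split a
... | inj₁ (_ , ex) = v , ≡trans ex e
... | inj₂ (e₁ , _) with ≡trans (sym e₁) e
... | ()

inDom-⊎ʳ : ∀ {h h₁ h₂ a} → h ≈ h₁ ⊎ₕ h₂ → InDom h₂ a → InDom h a
inDom-⊎ʳ {a = a} split (v , e) with split a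
... | inj₂ (_ , ex) = v , ≡trans ex e
... | inj₁ (e₂ , _) with ≡trans (sym e₂) e
... | ()

inDom-⊎-disjoint : ∀ {h h₁ h₂ a} → h ≈ h₁ ⊎ₕ h₂ → InDom h₁ a → InDom h₂ a → ⊥
inDom-⊎-disjoint {a = a} split (v , e₁') (w , e₂') with split a
... | inj₁ (e₂ , _) with ≡trans (sym e₂) e₂'
...   | ()
inDom-⊎-disjoint {a = a} split (v , e₁') (w , e₂') | inj₂ (e₁ , _) with ≡trans (sym e₁) e₁'
...   | ()

module Sorting (s : Store) where

  start end : Cell → ℕ
  start c = ⟦ startAddr c ⟧t s
  end   c = ⟦ endAddr c ⟧t s

  record Covers (h : Heap) (c : Cell) : Set where
    constructor covering
    field
      nonempty : start c ≤ end c
      inDom    : ∀ a → start c ≤ a → a ≤ end c → InDom h a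

  Apart : Cell → Cell → Set
  Apart c d = end c < start d ⊎ end d < start c

  SortedFrom : ℕ → List Cell → Set
  SortedFrom b []       = ⊤
  SortedFrom b (c ∷ cs) = b < start c × start c ≤ end c × SortedFrom (end c) cs

  insert : Cell → Spatial → Spatial
  insert c [] = cell c ∷ []
  insert c (Emp ∷ Σ) = Emp ∷ insert c Σ
  insert c (cell d ∷ Σ) with end c <? start d
  ... | yes _ = cell c ∷ cell d ∷ Σ
  ... | no  _ = cell d ∷ insert c Σ

  insert-↭ : ∀ c Σ → cell c ∷ Σ ↭ insert c Σ
  insert-↭ c [] = refl
  insert-↭ c (Emp ∷ Σ) = trans (swap (cell c) Emp refl) (prep Emp (insert-↭ c Σ))
  insert-↭ c (cell d ∷ Σ) with end c <? start d
  ... | yes _ = refl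
  ... | no  _ = trans (swap (cell c) (cell d) refl) (prep (cell d) (insert-↭ c Σ))

  insert-sorted : ∀ c Σ b → b < start c → start c ≤ end c →
    All (Apart c) (deleteEmp Σ) → SortedFrom b (deleteEmp Σ) →
    SortedFrom b (deleteEmp (insert c Σ))
  insert-sorted c [] b b<c c-ok _ _ = b<c , c-ok , tt
  insert-sorted c (Emp ∷ Σ) = insert-sorted c Σ
  insert-sorted c (cell d ∷ Σ) b b<c c-ok (apart ∷ aparts) (b<d , d-ok , sorted)
    with end c <? start d
  ... | yes c<d = b<c , c-ok , c<d , d-ok , sorted
  ... | no  c≮d with apart
  ...   | inj₁ c<d = ⊥-elim (c≮d c<d)
  ...   | inj₂ d<c = b<d , d-ok , insert-sorted c Σ (end d) d<c c-ok aparts sorted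

  arrCond-holds : ∀ c → start c ≤ end c → ⟦ arrCond c ⟧p s
  arrCond-holds (t ↦ₛ u) _  = tt
  arrCond-holds (Arr t u) ok = ok

  chainCond-holds : ∀ b c cs → SortedFrom b (c ∷ cs) → ⟦ chainCond (c ∷ cs) ⟧p s
  chainCond-holds b c []       (_ , ok , _)      = arrCond-holds c ok
  chainCond-holds b c (d ∷ cs) (_ , ok , sorted) =
    arrCond-holds c ok , proj₁ sorted , chainCond-holds (end c) d cs sorted

  Sorted-holds : ∀ Σ → SortedFrom 0 (deleteEmp Σ) → ⟦ Sorted Σ ⟧p s
  Sorted-holds Σ sorted with deleteEmp Σ
  ... | []     = tt , tt
  ... | c ∷ cs = proj₁ sorted , chainCond-holds 0 c cs sorted

  cell-covers : ∀ h c → satCell s h c → Covers h c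
  cell-covers h (t ↦ₛ u) (e , _) =
    covering ≤-refl λ a lo hi → subst (InDom h) (≤-antisym lo hi) (_ , e)
  cell-covers h (Arr t u) (ok , dom) =
    covering ok λ a lo hi → Equivalence.from (dom a) (lo , hi)

  covers-mono : ∀ {h h'} → (∀ {a} → InDom h a → InDom h' a) → ∀ {c} → Covers h c → Covers h' c
  covers-mono sub (covering ok dom) = covering ok λ a lo hi → sub (dom a lo hi)

  spatial-covers : ∀ h Σ → satSp s h Σ → All (Covers h) (deleteEmp Σ)
  spatial-covers h [] _ = []
  spatial-covers h (Emp ∷ Σ) (h₁ , h₂ , split , _ , sat) =
    All.map (covers-mono (inDom-⊎ʳ {h} {h₁} {h₂} split)) (spatial-covers h₂ Σ sat)
  spatial-covers h (cell c ∷ Σ) (h₁ , h₂ , split , satc , sat) =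
    covers-mono (inDom-⊎ˡ {h} {h₁} {h₂} split) (cell-covers h₁ c satc) ∷
    All.map (covers-mono (inDom-⊎ʳ {h} {h₁} {h₂} split)) (spatial-covers h₂ Σ sat)

  covers-apart : ∀ {h h₁ h₂} → h ≈ h₁ ⊎ₕ h₂ → ∀ {c d} → Covers h₁ c → Covers h₂ d → Apart c d
  covers-apart {h} {h₁} {h₂} split {c} {d} (covering c-ok c-dom) (covering d-ok d-dom)
    with end c <? start d | end d <? start c
  ... | yes c<d | _       = inj₁ c<d
  ... | no  _   | yes d<c = inj₂ d<c
  ... | no  c≮d | no  d≮c with ≤-total (start c) (start d)
  -- Otherwise the start of the later cell lies in both intervals.
  ...   | inj₁ c≤d = ⊥-elim (inDom-⊎-disjoint {h} {h₁} {h₂} split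
                       (c-dom (start d) c≤d (≮⇒≥ c≮d)) (d-dom (start d) ≤-refl d-ok))
  ...   | inj₂ d≤c = ⊥-elim (inDom-⊎-disjoint {h} {h₁} {h₂} split
                       (c-dom (start c) ≤-refl c-ok) (d-dom (start c) d≤c (≮⇒≥ d≮c)))

  -- Address 0 is never allocated, so covered cells start above 0.
  covers-start-pos : ∀ {h c} → Covers h c → 0 < start c
  covers-start-pos {h} {c} (covering ok dom) with start c | dom (start c) ≤-refl ok
  ... | zero  | (v , e) with ≡trans (sym (get0 h)) e
  ...   | ()
  covers-start-pos (covering ok dom) | suc k | _ = s≤s z≤n

  sort-model : ∀ h Σ → satSp s h Σ →
    ∃[ Σ' ] (Σ ↭ Σ' × satSp s h Σ' × SortedFrom 0 (deleteEmp Σ'))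
  sort-model h [] sat = [] , refl , sat , tt
  sort-model h (Emp ∷ Σ) (h₁ , h₂ , split , emp , sat) with sort-model h₂ Σ sat
  ... | Σ' , p , sat' , sorted = Emp ∷ Σ' , prep Emp p , (h₁ , h₂ , split , emp , sat') , sorted
  sort-model h (cell c ∷ Σ) (h₁ , h₂ , split , satc , sat) with sort-model h₂ Σ sat
  ... | Σ' , p , sat' , sorted =
    insert c Σ' ,
    trans (prep (cell c) p) (insert-↭ c Σ') ,
    satSp-↭ (insert-↭ c Σ') h (h₁ , h₂ , split , satc , sat') ,
    insert-sorted c Σ' 0 (covers-start-pos covers) (Covers.nonempty covers)
      (All.map (covers-apart {h} {h₁} {h₂} split covers) (spatial-covers h₂ Σ' sat')) sorted
    where covers = cell-covers h₁ c satc

open Sorting using (sort-model; Sorted-holds)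

satEx-mono : ∀ xs {P Q : Store → Set} → (∀ s → P s → Q s) → ∀ s → satEx xs P s → satEx xs Q s
satEx-mono []       f s sat       = f s sat
satEx-mono (x ∷ xs) f s (n , sat) = n , satEx-mono xs f (s [ x ↦ n ]) sat

satEx-choice : ∀ {A : Set} {R : A → Set} {P : Store → Set} {Q : A → Store → Set} xs →
  (∀ s → P s → ∃[ a ] (R a × Q a s)) →
  ∀ s → satEx xs P s → ∃[ a ] (R a × satEx xs (Q a) s)
satEx-choice []       choose s sat       = choose s sat
satEx-choice (x ∷ xs) choose s (n , sat) with satEx-choice xs choose (s [ x ↦ n ]) sat
... | a , r , sat' = a , r , n , sat'

tilde-perm-sound : ∀ {s h φ ψ} → ψ ∈Perm φ → s , h ⊨ tilde ψ → s , h ⊨ φ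
tilde-perm-sound {h = h} {φ = ⟨∃ xs · Π ∧ Σ ⟩} {ψ = ⟨∃ .xs · .Π ∧ Σ' ⟩} (≡refl , ≡refl , p) =
  satEx-mono xs (λ s ((π , _) , sat) → π , satSp-↭ p h sat) _

tilde-perm-complete : ∀ {s h} φ → s , h ⊨ φ → ∃[ ψ ] (ψ ∈Perm φ × s , h ⊨ tilde ψ)
tilde-perm-complete {s} {h} ⟨∃ xs · Π ∧ Σ ⟩ sat with satEx-choice xs sort s sat
  where
  sort : ∀ s' → ⟦ Π ⟧p s' × satSp s' h Σ →
    ∃[ Σ' ] (Σ' ↭ Σ × (⟦ Π ∧' Sorted Σ' ⟧p s' × satSp s' h Σ'))
  sort s' (π , satΣ) with sort-model s' h Σ satΣ
  ... | Σ' , p , satΣ' , sorted = Σ' , ↭-sym p , (π , Sorted-holds s' Σ' sorted) , satΣ'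
... | Σ' , p , sat' = ⟨∃ xs · Π ∧ Σ' ⟩ , (≡refl , ≡refl , p) , sat'

lemma3p1 : (Π : PF) (Σ : Spatial) (n : ℕ) (ϕ : Fin n → SH) (s : Store) →
    Cond-i s ⟨∃ [] · Π ∧ Σ ⟩ n ϕ ⇔ Cond-ii s ⟨∃ [] · Π ∧ Σ ⟩ n ϕ
lemma3p1 Π Σ n ϕ s = mk⇔ i⇒ii ii⇒i
  where
  φ = ⟨∃ [] · Π ∧ Σ ⟩

  i⇒ii : Cond-i s φ n ϕ → Cond-ii s φ n ϕ
  i⇒ii cond-i h sat with tilde-perm-complete φ sat
  ... | φ' , perm , sat' with cond-i φ' perm h sat'
  ...   | i , ψ , permψ , satψ = i , tilde-perm-sound permψ satψ

  ii⇒i : Cond-ii s φ n ϕ → Cond-i s φ n ϕ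
  ii⇒i cond-ii φ' perm h sat with cond-ii h (tilde-perm-sound perm sat)
  ... | i , satᵢ with tilde-perm-complete (ϕ i) satᵢ
  ...   | ψ , permψ , satψ = i , ψ , permψ , satψ
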